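{- Let $0 \le \alpha \le 1/3$, and let $(G, k, p)$ with $G=(V,E)$ be a yes-instance of Min $\alpha$-FCGP. Let $\sigma = v_1, \ldots, v_n$ be an ordering of $V$ with $d(v_1) \le d(v_2) \le \cdots \le d(v_n)$ (ties broken arbitrarily), and for each $j$ let $V_\sigma^j = \{v_1,\ldots,v_j\}$. Let $C$ be the lexicographically smallest solution (with respect to $\sigma$), and let $v_j$ be the last vertex of $C$ in the ordering $\sigma$. Then $C$ is a dominating set of size $k$ of $G[V_\sigma^j]$.
   Context: Graphs are finite, simple and undirected; $d(v)$ denotes the degree of $v$. For vertex sets $X, Y$, $m(X)$ is the number of edges with both endpoints in $X$ and $m(X,Y)$ is the number of edges with one endpoint in $X$ and the other in $Y$. For $S \subseteq V$, $\mathrm{cov}_{\alpha}(S) = (1-\alpha)\cdot m(S) + \alpha \cdot m(S, V \setminus S)$. Min $\alpha$-FCGP: given $G$ and nonnegative integers $k,p$, decide whether there is $S\subseteq V$ with $|S|=k$ and $\mathrm{cov}_\alpha(S)\le p$; such an $S$ is a solution. Solutions are compared lexicographically by writing each as the increasing sequence of the $\sigma$-indices of its vertices. A set $C$ dominates $G[V_\sigma^j]$ if every vertex of $V_\sigma^j$ is in $C$ or adjacent to a vertex of $C$.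
   Formalization: The parameter α, with $0 \le \alpha \le 1/3$, ranges over the rationals instead of the reals. -}

module Defs where

open import Data.Bool using (Bool; true; false; _∧_; not)
open import Data.Nat as ℕ using (ℕ)
open import Data.Fin as Fin using (Fin; toℕ)
open import Data.Fin.Subset using (Subset; _∈_; ∣_∣)
import Data.List as List
open import Data.List using (List; filter; map)
open import Data.Nat.ListAction using (sum)
open import Data.List.Relation.Binary.Lex.Core using (Lex-≤)
open import Data.Vec using (lookup)
open import Data.Integer using (+_)
open import Data.Rational as ℚ using (ℚ; _/_; 1ℚ)
open import Data.Product using (Σ; _×_; ∃)
open import Data.Sum using (_⊎_)
open import Relation.Binary.PropositionalEquality using (_≡_)
open import Relation.Nullary.Decidable using (⌊_⌋)
open import Data.Fin.Subset.Properties using (_∈?_)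

record Graph (n : ℕ) : Set where
  field
    adj   : Fin n → Fin n → Bool
    sym   : ∀ u v → adj u v ≡ adj v u
    irref : ∀ v → adj v v ≡ false
open Graph public

b2n : Bool → ℕ
b2n true  = 1
b2n false = 0

sumFin : {n : ℕ} → (Fin n → ℕ) → ℕ
sumFin {n} f = sum (map f (List.allFin n))

countFin : {n : ℕ} → (Fin n → Bool) → ℕ
countFin P = sumFin (λ u → b2n (P u))

deg : {n : ℕ} → Graph n → Fin n → ℕ
deg G v = countFin (λ u → adj G v u)

-- m(S): number of edges with both endpoints in S (unordered pair {u,v} counted once via u < v)
mIn : {n : ℕ} → Graph n → Subset n → ℕ
mIn G S = sumFin (λ u → countFin (λ v →
            ⌊ toℕ u ℕ.<? toℕ v ⌋ ∧ adj G u v ∧ lookup S u ∧ lookup S v))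

mCut : {n : ℕ} → Graph n → Subset n → ℕ
mCut G S = sumFin (λ u → countFin (λ v →
            adj G u v ∧ lookup S u ∧ not (lookup S v)))

ℕtoℚ : ℕ → ℚ
ℕtoℚ m = + m / 1

cov : {n : ℕ} → ℚ → Graph n → Subset n → ℚ
cov α G S = ((1ℚ ℚ.- α) ℚ.* ℕtoℚ (mIn G S)) ℚ.+ (α ℚ.* ℕtoℚ (mCut G S))

IsSolution : {n : ℕ} → ℚ → Graph n → ℕ → ℕ → Subset n → Set
IsSolution α G k p S = (∣ S ∣ ≡ k) × (cov α G S ℚ.≤ ℕtoℚ p)

YesInstance : {n : ℕ} → ℚ → Graph n → ℕ → ℕ → Set
YesInstance {n} α G k p = ∃ λ (S : Subset n) → IsSolution α G k p S

-- The ordering σ = v_1,…,v_n is given as a bijection σ : Fin n → Fin n,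
-- σ i being the vertex at position i (0-based).
-- σ-indices of the vertices of S, in increasing order.
σseq : {n : ℕ} → (Fin n → Fin n) → Subset n → List (Fin n)
σseq {n} σ S = filter (λ i → σ i ∈? S) (List.allFin n)

_≤lex[_]_ : {n : ℕ} → Subset n → (Fin n → Fin n) → Subset n → Set
S ≤lex[ σ ] T = Lex-≤ _≡_ Fin._<_ (σseq σ S) (σseq σ T)

IsLexMinSolution : {n : ℕ} → ℚ → Graph n → ℕ → ℕ → (Fin n → Fin n) → Subset n → Set
IsLexMinSolution {n} α G k p σ C =
  IsSolution α G k p C × (∀ (S : Subset n) → IsSolution α G k p S → C ≤lex[ σ ] S)

IsDomSetOfPrefix : {n : ℕ} → Graph n → (Fin n → Fin n) → Fin n → ℕ → Subset n → Set
IsDomSetOfPrefix {n} G σ j k C =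
  (∀ (i : Fin n) → σ i ∈ C → i Fin.≤ j)
  × (∣ C ∣ ≡ k)
  × (∀ (i : Fin n) → i Fin.≤ j →
       (σ i ∈ C) ⊎ (Σ (Fin n) λ i' → i' Fin.≤ j × σ i' ∈ C × adj G (σ i) (σ i') ≡ true))

module Submission where

-- If some σ i with i ≤ j were neither in C nor adjacent to C, swapping the last vertex σ j of C
-- for σ i would give a set of the same size that is lexicographically smaller.  Removing σ j
-- deletes its a neighbours in C from m(C) and changes the cut by 2a − d(σ j), while adding σ i,
-- which has no neighbour in C, adds d(σ i) ≤ d(σ j) cut edges.  For α ≤ 1/3 the net change of
-- cov_α is at most (3α − 1)·a ≤ 0, so the smaller set would still be a solution.

open import Defs hiding (sym)
open import Data.Bool using (Bool; true; false; _∧_; not; if_then_else_) renaming (_≟_ to _≟ᵇ_)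
open import Data.Bool.Properties using (∧-zeroʳ; ∧-identityʳ; ¬-not)
open import Data.Fin as Fin using (Fin; toℕ; _<_; punchIn; punchOut)
open import Data.Fin.Properties
  using (_≟_; <-cmp; <-asym; <-trans; <⇒≢; ≤∧≢⇒<; punchInᵢ≢i; punchOut-injective; injective⇒≤; any?)
  renaming (<-irrefl to <-irreflᶠ)
open import Data.Fin.Subset using (Subset; _∈_; _∉_; ∣_∣)
open import Data.Fin.Subset.Properties using (_∈?_)
open import Data.Integer using (+_)
import Data.Integer as ℤ
import Data.Integer.Properties as ℤ
import Data.List as List
open import Data.List using ([]; _∷_; filter)
open import Data.List.Membership.Propositional using () renaming (_∈_ to _∈ˡ_)
open import Data.List.Membership.Propositional.Properties using (∈-filter⁺; ∈-filter⁻; ∈-allFin)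
open import Data.List.Properties using (map-tabulate)
open import Data.List.Relation.Binary.Lex.Core using (Lex-≤; this; next)
import Data.List.Relation.Unary.All as All
open import Data.List.Relation.Unary.AllPairs using (AllPairs; _∷_)
open import Data.List.Relation.Unary.AllPairs.Properties using (tabulate⁺-<)
open import Data.List.Relation.Unary.Any using (here; there)
open import Data.Nat as ℕ using (ℕ; _≤_)
import Data.Nat.ListAction as ListAction
open import Data.Nat.Coprimality using (1-coprimeTo) renaming (sym to coprime-sym)
open import Data.Nat.Properties
  using (+-0-commutativeMonoid; +-identityʳ; +-assoc; +-monoʳ-≤; <-irrefl; n≮n; module ≤-Reasoning)
open import Algebra.Properties.CommutativeMonoid.Sum +-0-commutativeMonoid
  using (sum; sum-syntax; sum-cong-≗; sum-remove; sum-replicate-zero; ∑-distrib-+; ∑-comm)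
open import Data.Product using (Σ; ∃; _×_; _,_; proj₁)
open import Data.Rational using (ℚ; 0ℚ; _/_) renaming (_≤_ to _≤ℚ_)
import Data.Rational as Rat
import Data.Rational.Properties as Rat
open import Data.Rational.Solver using (module +-*-Solver)
open import Data.Sum using (_⊎_; inj₁; inj₂)
open import Data.Vec using (lookup; _[_]≔_; _∷_)
open import Data.Vec.Properties
  using (lookup∘update; lookup∘update′; []≔-updates; []≔-idempotent; []≔-lookup; []=⇒lookup; lookup⇒[]=)
open import Function using (id; _∘_)
open import Function.Definitions using (Injective)
open import Level using (0ℓ)
open import Relation.Binary.Definitions using (tri<; tri≈; tri>)
open import Relation.Binary.PropositionalEquality
  using (_≡_; _≢_; refl; sym; trans; cong; cong₂; subst; module ≡-Reasoning)
open import Relation.Nullary using (does; yes; no; ¬_; contradiction)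
open import Relation.Nullary.Decidable
  using (⌊_⌋; dec-true; dec-false; isYes≗does; _×-dec_; _⊎-dec_; decidable-stable)
open import Relation.Unary using (Pred; Decidable)

sum-tabulate : {n : ℕ} (f : Fin n → ℕ) → ListAction.sum (List.tabulate f) ≡ sum f
sum-tabulate {ℕ.zero} f = refl
sum-tabulate {ℕ.suc n} f = cong (f Fin.zero ℕ.+_) (sum-tabulate (f ∘ Fin.suc))

sumFin≡∑ : {n : ℕ} (f : Fin n → ℕ) → sumFin f ≡ ∑[ i < n ] f i
sumFin≡∑ {n} f = trans (cong ListAction.sum (map-tabulate (λ i → i) f)) (sum-tabulate f)

sumFin²≡∑∑ : {n : ℕ} (F : Fin n → Fin n → ℕ) →
             sumFin (λ u → sumFin (F u)) ≡ ∑[ u < n ] ∑[ v < n ] F u v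
sumFin²≡∑∑ F = trans (sumFin≡∑ (λ u → sumFin (F u))) (sum-cong-≗ (λ u → sumFin≡∑ (F u)))

∑∑-distrib-+ : {n : ℕ} (F F′ : Fin n → Fin n → ℕ) →
               ∑[ u < n ] ∑[ v < n ] (F u v ℕ.+ F′ u v)
                 ≡ ∑[ u < n ] ∑[ v < n ] F u v ℕ.+ ∑[ u < n ] ∑[ v < n ] F′ u v
∑∑-distrib-+ {n} F F′ = trans (sum-cong-≗ (λ u → ∑-distrib-+ (F u) (F′ u)))
                              (∑-distrib-+ (λ u → ∑[ v < n ] F u v) (λ u → ∑[ v < n ] F′ u v))

onlyAt : {n : ℕ} → Fin n → ℕ → Fin n → ℕ
onlyAt x c u = if does (u ≟ x) then c else 0

onlyAt-diag : {n : ℕ} (x : Fin n) (c : ℕ) → onlyAt x c x ≡ c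
onlyAt-diag x c rewrite dec-true (x ≟ x) refl = refl

onlyAt-≢ : {n : ℕ} {x u : Fin n} (c : ℕ) → u ≢ x → onlyAt x c u ≡ 0
onlyAt-≢ {x = x} {u} c u≢x rewrite dec-false (u ≟ x) u≢x = refl

∑-onlyAt : {n : ℕ} (x : Fin n) (g : Fin n → ℕ) → ∑[ u < n ] onlyAt x (g u) u ≡ g x
∑-onlyAt {ℕ.suc n} x g = begin
  ∑[ u < ℕ.suc n ] onlyAt x (g u) u
    ≡⟨ sum-remove {i = x} (λ u → onlyAt x (g u) u) ⟩
  onlyAt x (g x) x ℕ.+ ∑[ u < n ] onlyAt x (g (punchIn x u)) (punchIn x u)
    ≡⟨ cong₂ ℕ._+_ (onlyAt-diag x (g x))
                   (trans (sum-cong-≗ (λ u → onlyAt-≢ _ (punchInᵢ≢i x u))) (sum-replicate-zero n)) ⟩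
  g x ℕ.+ 0
    ≡⟨ +-identityʳ (g x) ⟩
  g x ∎
  where open ≡-Reasoning

∑∑-onlyAt-row : {n : ℕ} (x : Fin n) (r : Fin n → ℕ) →
                ∑[ u < n ] ∑[ v < n ] onlyAt x (r v) u ≡ ∑[ v < n ] r v
∑∑-onlyAt-row x r = trans (∑-comm (λ u v → onlyAt x (r v) u)) (sum-cong-≗ (λ v → ∑-onlyAt x (λ _ → r v)))

∑∑-onlyAt-col : {n : ℕ} (x : Fin n) (c : Fin n → ℕ) →
                ∑[ u < n ] ∑[ v < n ] onlyAt x (c u) v ≡ ∑[ u < n ] c u
∑∑-onlyAt-col x c = sum-cong-≗ (λ u → ∑-onlyAt x (λ _ → c u))

-- Without the later element e′ kept by P, the P-list could be a proper prefix of the Q-list.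
module FirstDifference {n : ℕ} {P Q : Pred (Fin n) 0ℓ} (P? : Decidable P) (Q? : Decidable Q)
  {e e′ : Fin n} (e<e′ : e < e′) (P⇒Q : ∀ {x} → x < e → P x → Q x) (Q⇒P : ∀ {x} → x < e → Q x → P x)
  (Qe : Q e) (¬Pe : ¬ P e) (Pe′ : P e′) where

  private
    above-≰lex : ∀ {xs ys} → (∀ {z} → z ∈ˡ xs → e < z) → e′ ∈ˡ xs → ¬ Lex-≤ _≡_ _<_ xs (e ∷ ys)
    above-≰lex {[]}    _    ()
    above-≰lex {z ∷ _} e<xs _ (this z<e)   = <-asym z<e (e<xs (here refl))
    above-≰lex {z ∷ _} e<xs _ (next z≡e _) = <-irreflᶠ (sym z≡e) (e<xs (here refl))

  filter-≰lex : ∀ {xs} → AllPairs _<_ xs → e ∈ˡ xs → e′ ∈ˡ xs →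
                ¬ Lex-≤ _≡_ _<_ (filter P? xs) (filter Q? xs)
  filter-≰lex {y ∷ ys} _ (here refl) (here refl) _ = <-irreflᶠ refl e<e′
  filter-≰lex {y ∷ ys} (y<ys ∷ _) (here refl) (there e′∈ys) with P? y | Q? y
  ... | yes Py | _      = contradiction Py ¬Pe
  ... | no _   | no ¬Qy = contradiction Qe ¬Qy
  ... | no _   | yes _  =
    above-≰lex (λ z∈ → All.lookup y<ys (proj₁ (∈-filter⁻ P? z∈))) (∈-filter⁺ P? e′∈ys Pe′)
  filter-≰lex {y ∷ ys} (y<ys ∷ _) (there e∈ys) (here refl) _ = <-asym e<e′ (All.lookup y<ys e∈ys)
  filter-≰lex {y ∷ ys} (y<ys ∷ sorted) (there e∈ys) (there e′∈ys) lex with P? y | Q? y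
  ... | yes Py  | no ¬Qy = ¬Qy (P⇒Q (All.lookup y<ys e∈ys) Py)
  ... | no ¬Py  | yes Qy = ¬Py (Q⇒P (All.lookup y<ys e∈ys) Qy)
  ... | no _    | no _   = filter-≰lex sorted e∈ys e′∈ys lex
  ... | yes _   | yes _ with lex
  ...   | this y<y     = <-irreflᶠ refl y<y
  ...   | next _ lex′  = filter-≰lex sorted e∈ys e′∈ys lex′

_<ᵇ_ : {n : ℕ} → Fin n → Fin n → Bool
u <ᵇ v = ⌊ toℕ u ℕ.<? toℕ v ⌋

<ᵇ-true : {n : ℕ} {u v : Fin n} → u < v → (u <ᵇ v) ≡ true
<ᵇ-true {u = u} {v} u<v = trans (isYes≗does (toℕ u ℕ.<? toℕ v)) (dec-true (toℕ u ℕ.<? toℕ v) u<v)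

<ᵇ-false : {n : ℕ} {u v : Fin n} → ¬ (u < v) → (u <ᵇ v) ≡ false
<ᵇ-false {u = u} {v} u≮v = trans (isYes≗does (toℕ u ℕ.<? toℕ v)) (dec-false (toℕ u ℕ.<? toℕ v) u≮v)

<ᵇ-irrefl : {n : ℕ} (x : Fin n) → (x <ᵇ x) ≡ false
<ᵇ-irrefl x = <ᵇ-false (<-irrefl refl)

<ᵇ-split : {n : ℕ} {u v : Fin n} → u ≢ v → (b : Bool) →
           b2n (u <ᵇ v ∧ b) ℕ.+ b2n (v <ᵇ u ∧ b) ≡ b2n b
<ᵇ-split {u = u} {v} u≢v b with <-cmp u v
... | tri< u<v _ _ rewrite <ᵇ-true u<v | <ᵇ-false (<-asym u<v) = +-identityʳ (b2n b)
... | tri≈ _ u≡v _ = contradiction u≡v u≢v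
... | tri> _ _ v<u rewrite <ᵇ-false (<-asym v<u) | <ᵇ-true v<u = refl

b2n-split : (a b : Bool) → b2n (a ∧ not b) ℕ.+ b2n (a ∧ b) ≡ b2n a
b2n-split false b     = refl
b2n-split true  false = refl
b2n-split true  true  = refl

∣insert∣ : {n : ℕ} (S : Subset n) (x : Fin n) → lookup S x ≡ false → ∣ S [ x ]≔ true ∣ ≡ ℕ.suc ∣ S ∣
∣insert∣ (false ∷ S) Fin.zero    refl = refl
∣insert∣ (true  ∷ S) (Fin.suc x) x∉S  = cong ℕ.suc (∣insert∣ S x x∉S)
∣insert∣ (false ∷ S) (Fin.suc x) x∉S  = ∣insert∣ S x x∉S

insert-remove : {n : ℕ} (S : Subset n) {x : Fin n} → lookup S x ≡ true → (S [ x ]≔ false) [ x ]≔ true ≡ S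
insert-remove S {x} x∈S = begin
  (S [ x ]≔ false) [ x ]≔ true ≡⟨ []≔-idempotent S x ⟩
  S [ x ]≔ true                ≡⟨ cong (S [ x ]≔_) (sym x∈S) ⟩
  S [ x ]≔ lookup S x          ≡⟨ []≔-lookup S x ⟩
  S ∎
  where open ≡-Reasoning

remove-⊆ : {n : ℕ} (S : Subset n) (x v : Fin n) → lookup (S [ x ]≔ false) v ≡ true → lookup S v ≡ true
remove-⊆ S x v v∈S₋ with v ≟ x
... | yes refl = contradiction (trans (sym v∈S₋) (lookup∘update x S false)) λ ()
... | no v≢x   = trans (sym (lookup∘update′ v≢x S false)) v∈S₋

nbrsIn : {n : ℕ} → Graph n → Subset n → Fin n → ℕ
nbrsIn {n} G S x = ∑[ v < n ] b2n (adj G x v ∧ lookup S v)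

nbrsIn≡0 : {n : ℕ} (G : Graph n) (S : Subset n) (x : Fin n) →
           (∀ v → lookup S v ≡ true → adj G x v ≡ false) → nbrsIn G S x ≡ 0
nbrsIn≡0 {n} G S x isolated = trans (sum-cong-≗ no-edge) (sum-replicate-zero n)
  where
  no-edge : ∀ v → b2n (adj G x v ∧ lookup S v) ≡ 0
  no-edge v with lookup S v in v∈S
  ... | true rewrite isolated v v∈S = refl
  ... | false rewrite ∧-zeroʳ (adj G x v) = refl

module Insertion {n : ℕ} (G : Graph n) (S : Subset n) (x : Fin n) (x∉S : lookup S x ≡ false) where

  private
    within : Subset n → Fin n → Fin n → ℕ
    within T u v = b2n (u <ᵇ v ∧ adj G u v ∧ lookup T u ∧ lookup T v)

    crossing : Subset n → Fin n → Fin n → ℕ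
    crossing T u v = b2n (adj G u v ∧ lookup T u ∧ not (lookup T v))

    within-insert : ∀ u v → within (S [ x ]≔ true) u v
      ≡ within S u v ℕ.+ onlyAt x (b2n (x <ᵇ v ∧ adj G x v ∧ lookup S v)) u
                     ℕ.+ onlyAt x (b2n (u <ᵇ x ∧ adj G u x ∧ lookup S u)) v
    within-insert u v with u ≟ x | v ≟ x
    ... | yes refl | yes refl rewrite <ᵇ-irrefl x = refl
    ... | yes refl | no v≢x
      rewrite lookup∘update x S true | lookup∘update′ v≢x S true | x∉S
            | ∧-zeroʳ (adj G x v) | ∧-zeroʳ (x <ᵇ v)
      = sym (+-identityʳ _)
    ... | no u≢x | yes refl
      rewrite lookup∘update x S true | lookup∘update′ u≢x S true | x∉S
            | ∧-identityʳ (lookup S u) | ∧-zeroʳ (lookup S u) | ∧-zeroʳ (adj G u x) | ∧-zeroʳ (u <ᵇ x)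
      = refl
    ... | no u≢x | no v≢x rewrite lookup∘update′ u≢x S true | lookup∘update′ v≢x S true
      = sym (trans (+-identityʳ _) (+-identityʳ _))

    crossing-insert : ∀ u v →
      crossing (S [ x ]≔ true) u v ℕ.+ onlyAt x (b2n (adj G u x ∧ lookup S u)) v
        ≡ crossing S u v ℕ.+ onlyAt x (b2n (adj G x v ∧ not (lookup S v))) u
    crossing-insert u v with u ≟ x | v ≟ x
    ... | yes refl | yes refl rewrite irref G x = refl
    ... | yes refl | no v≢x
      rewrite lookup∘update x S true | lookup∘update′ v≢x S true | x∉S | ∧-zeroʳ (adj G x v)
      = +-identityʳ _
    ... | no u≢x | yes refl
      rewrite lookup∘update x S true | lookup∘update′ u≢x S true | x∉S
            | ∧-identityʳ (lookup S u) | ∧-zeroʳ (lookup S u) | ∧-zeroʳ (adj G u x)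
      = sym (+-identityʳ _)
    ... | no u≢x | no v≢x rewrite lookup∘update′ u≢x S true | lookup∘update′ v≢x S true = refl

    edges-before+after : ∀ v →
      b2n (x <ᵇ v ∧ adj G x v ∧ lookup S v) ℕ.+ b2n (v <ᵇ x ∧ adj G v x ∧ lookup S v)
        ≡ b2n (adj G x v ∧ lookup S v)
    edges-before+after v with v ≟ x
    ... | yes refl rewrite irref G x | <ᵇ-irrefl x = refl
    ... | no v≢x rewrite Graph.sym G v x = <ᵇ-split (v≢x ∘ sym) (adj G x v ∧ lookup S v)

  mIn-insert : mIn G (S [ x ]≔ true) ≡ mIn G S ℕ.+ nbrsIn G S x
  mIn-insert = begin
    mIn G (S [ x ]≔ true)
      ≡⟨ sumFin²≡∑∑ (within (S [ x ]≔ true)) ⟩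
    ∑[ u < n ] ∑[ v < n ] within (S [ x ]≔ true) u v
      ≡⟨ sum-cong-≗ (λ u → sum-cong-≗ (within-insert u)) ⟩
    ∑[ u < n ] ∑[ v < n ] (within S u v ℕ.+ onlyAt x (after v) u ℕ.+ onlyAt x (before u) v)
      ≡⟨ ∑∑-distrib-+ (λ u v → within S u v ℕ.+ onlyAt x (after v) u) (λ u v → onlyAt x (before u) v) ⟩
    ∑[ u < n ] ∑[ v < n ] (within S u v ℕ.+ onlyAt x (after v) u)
      ℕ.+ ∑[ u < n ] ∑[ v < n ] onlyAt x (before u) v
      ≡⟨ cong₂ ℕ._+_ (∑∑-distrib-+ (within S) (λ u v → onlyAt x (after v) u)) (∑∑-onlyAt-col x before) ⟩
    ∑[ u < n ] ∑[ v < n ] within S u v ℕ.+ ∑[ u < n ] ∑[ v < n ] onlyAt x (after v) u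
      ℕ.+ ∑[ u < n ] before u
      ≡⟨ cong₂ (λ m a → m ℕ.+ a ℕ.+ ∑[ u < n ] before u) (sym (sumFin²≡∑∑ (within S))) (∑∑-onlyAt-row x after) ⟩
    mIn G S ℕ.+ ∑[ v < n ] after v ℕ.+ ∑[ v < n ] before v
      ≡⟨ +-assoc (mIn G S) _ _ ⟩
    mIn G S ℕ.+ (∑[ v < n ] after v ℕ.+ ∑[ v < n ] before v)
      ≡⟨ cong (mIn G S ℕ.+_) (trans (sym (∑-distrib-+ after before)) (sum-cong-≗ edges-before+after)) ⟩
    mIn G S ℕ.+ nbrsIn G S x ∎
    where
    open ≡-Reasoning
    after before : Fin n → ℕ
    after  v = b2n (x <ᵇ v ∧ adj G x v ∧ lookup S v)
    before u = b2n (u <ᵇ x ∧ adj G u x ∧ lookup S u)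

  private
    crossing-sum : mCut G (S [ x ]≔ true) ℕ.+ ∑[ u < n ] b2n (adj G u x ∧ lookup S u)
                 ≡ mCut G S ℕ.+ ∑[ v < n ] b2n (adj G x v ∧ not (lookup S v))
    crossing-sum = begin
      mCut G (S [ x ]≔ true) ℕ.+ ∑[ u < n ] into u
        ≡⟨ cong₂ ℕ._+_ (sumFin²≡∑∑ (crossing (S [ x ]≔ true))) (sym (∑∑-onlyAt-col x into)) ⟩
      ∑[ u < n ] ∑[ v < n ] crossing (S [ x ]≔ true) u v ℕ.+ ∑[ u < n ] ∑[ v < n ] onlyAt x (into u) v
        ≡⟨ sym (∑∑-distrib-+ (crossing (S [ x ]≔ true)) (λ u v → onlyAt x (into u) v)) ⟩
      ∑[ u < n ] ∑[ v < n ] (crossing (S [ x ]≔ true) u v ℕ.+ onlyAt x (into u) v)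
        ≡⟨ sum-cong-≗ (λ u → sum-cong-≗ (crossing-insert u)) ⟩
      ∑[ u < n ] ∑[ v < n ] (crossing S u v ℕ.+ onlyAt x (outOf v) u)
        ≡⟨ ∑∑-distrib-+ (crossing S) (λ u v → onlyAt x (outOf v) u) ⟩
      ∑[ u < n ] ∑[ v < n ] crossing S u v ℕ.+ ∑[ u < n ] ∑[ v < n ] onlyAt x (outOf v) u
        ≡⟨ cong₂ ℕ._+_ (sym (sumFin²≡∑∑ (crossing S))) (∑∑-onlyAt-row x outOf) ⟩
      mCut G S ℕ.+ ∑[ v < n ] outOf v ∎
      where
      open ≡-Reasoning
      into outOf : Fin n → ℕ
      into  u = b2n (adj G u x ∧ lookup S u)
      outOf v = b2n (adj G x v ∧ not (lookup S v))

  mCut-insert : mCut G (S [ x ]≔ true) ℕ.+ nbrsIn G S x ℕ.+ nbrsIn G S x ≡ mCut G S ℕ.+ deg G x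
  mCut-insert = begin
    mCut G (S [ x ]≔ true) ℕ.+ nbrsIn G S x ℕ.+ nbrsIn G S x
      ≡⟨ cong (λ t → mCut G (S [ x ]≔ true) ℕ.+ t ℕ.+ nbrsIn G S x)
              (sum-cong-≗ (λ u → cong (λ b → b2n (b ∧ lookup S u)) (Graph.sym G x u))) ⟩
    mCut G (S [ x ]≔ true) ℕ.+ ∑[ u < n ] b2n (adj G u x ∧ lookup S u) ℕ.+ nbrsIn G S x
      ≡⟨ cong (ℕ._+ nbrsIn G S x) crossing-sum ⟩
    mCut G S ℕ.+ ∑[ v < n ] outOf v ℕ.+ nbrsIn G S x
      ≡⟨ +-assoc (mCut G S) _ _ ⟩
    mCut G S ℕ.+ (∑[ v < n ] outOf v ℕ.+ nbrsIn G S x)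
      ≡⟨ cong (mCut G S ℕ.+_) (trans (sym (∑-distrib-+ outOf (λ v → b2n (adj G x v ∧ lookup S v))))
                                    (sum-cong-≗ (λ v → b2n-split (adj G x v) (lookup S v)))) ⟩
    mCut G S ℕ.+ ∑[ v < n ] b2n (adj G x v)
      ≡⟨ cong (mCut G S ℕ.+_) (sym (sumFin≡∑ (λ v → b2n (adj G x v)))) ⟩
    mCut G S ℕ.+ deg G x ∎
    where
    open ≡-Reasoning
    outOf : Fin n → ℕ
    outOf v = b2n (adj G x v ∧ not (lookup S v))

module _ where
  open import Data.Rational using (1ℚ; _+_; _-_; _*_)

  ℕtoℚ≡mkℚ : ∀ m → ℕtoℚ m ≡ Rat.mkℚ (+ m) 0 (coprime-sym (1-coprimeTo m))
  ℕtoℚ≡mkℚ m = Rat.normalize-coprime (coprime-sym (1-coprimeTo m))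

  ℕtoℚ-+ : ∀ a b → ℕtoℚ (a ℕ.+ b) ≡ ℕtoℚ a + ℕtoℚ b
  ℕtoℚ-+ a b rewrite ℕtoℚ≡mkℚ a | ℕtoℚ≡mkℚ b =
    cong (_/ 1) (sym (cong₂ ℤ._+_ (ℤ.*-identityʳ (+ a)) (ℤ.*-identityʳ (+ b))))

  ℕtoℚ-mono-≤ : ∀ {a b} → a ≤ b → ℕtoℚ a ≤ℚ ℕtoℚ b
  ℕtoℚ-mono-≤ {a} {b} a≤b rewrite ℕtoℚ≡mkℚ a | ℕtoℚ≡mkℚ b =
    Rat.*≤* (ℤ.*-monoʳ-≤-nonNeg (+ 1) (ℤ.+≤+ a≤b))

  -- This is where α ≤ 1/3 is needed: the a internal edges that are lost save (1 − α)·a,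
  -- while the cut grows by at most 2a, costing 2α·a.
  swap-cost-≤ : ∀ {α} → 0ℚ ≤ℚ α → α ≤ℚ + 1 / 3 → ∀ m a c c′ → c′ ≤ c ℕ.+ (a ℕ.+ a) →
    (1ℚ - α) * ℕtoℚ m + α * ℕtoℚ c′ ≤ℚ (1ℚ - α) * ℕtoℚ (m ℕ.+ a) + α * ℕtoℚ c
  swap-cost-≤ {α} 0≤α α≤⅓ m a c c′ c′≤c+2a = begin
    (1ℚ - α) * M + α * C′
      ≤⟨ Rat.+-monoʳ-≤ ((1ℚ - α) * M) (Rat.*-monoˡ-≤-nonNeg α C′≤C+2A) ⟩
    (1ℚ - α) * M + α * (C + (A + A))
      ≡⟨ regroup₁ α M A C ⟩
    ((1ℚ - α) * M + α * C - α * A) + (α + α + α) * A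
      ≤⟨ Rat.+-monoʳ-≤ ((1ℚ - α) * M + α * C - α * A)
                     (Rat.*-monoʳ-≤-nonNeg A (Rat.+-mono-≤ (Rat.+-mono-≤ α≤⅓ α≤⅓) α≤⅓)) ⟩
    ((1ℚ - α) * M + α * C - α * A) + 1ℚ * A
      ≡⟨ regroup₂ α M A C ⟩
    (1ℚ - α) * (M + A) + α * C
      ≡⟨ cong (λ t → (1ℚ - α) * t + α * C) (sym (ℕtoℚ-+ m a)) ⟩
    (1ℚ - α) * ℕtoℚ (m ℕ.+ a) + α * C ∎
    where
    open Rat.≤-Reasoning
    open +-*-Solver
    M A C C′ : ℚ
    M = ℕtoℚ m
    A = ℕtoℚ a
    C = ℕtoℚ c
    C′ = ℕtoℚ c′
    instance
      _ : Rat.NonNegative α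
      _ = Rat.nonNegative 0≤α
      _ : Rat.NonNegative A
      _ = Rat.nonNegative (ℕtoℚ-mono-≤ {0} {a} ℕ.z≤n)
    C′≤C+2A : C′ ≤ℚ C + (A + A)
    C′≤C+2A = subst (C′ ≤ℚ_) (trans (ℕtoℚ-+ c (a ℕ.+ a)) (cong (λ t → C + t) (ℕtoℚ-+ a a))) (ℕtoℚ-mono-≤ c′≤c+2a)
    regroup₁ : ∀ α M A C → (1ℚ - α) * M + α * (C + (A + A)) ≡ ((1ℚ - α) * M + α * C - α * A) + (α + α + α) * A
    regroup₁ = solve 4 (λ α M A C → (con 1ℚ :- α) :* M :+ α :* (C :+ (A :+ A))
                                  := ((con 1ℚ :- α) :* M :+ α :* C :- α :* A) :+ (α :+ α :+ α) :* A) refl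
    regroup₂ : ∀ α M A C → ((1ℚ - α) * M + α * C - α * A) + 1ℚ * A ≡ (1ℚ - α) * (M + A) + α * C
    regroup₂ = solve 4 (λ α M A C → ((con 1ℚ :- α) :* M :+ α :* C :- α :* A) :+ con 1ℚ :* A
                                  := (con 1ℚ :- α) :* (M :+ A) :+ α :* C) refl

  mCut-swap-≤ : {n : ℕ} (G : Graph n) (T : Subset n) (u w : Fin n) →
                lookup T u ≡ false → lookup T w ≡ false → nbrsIn G T u ≡ 0 → deg G u ≤ deg G w →
                mCut G (T [ u ]≔ true) ≤ mCut G (T [ w ]≔ true) ℕ.+ (nbrsIn G T w ℕ.+ nbrsIn G T w)
  mCut-swap-≤ G T u w u∉T w∉T no-nbrs du≤dw = begin
    mCut G (T [ u ]≔ true)                                   ≡⟨ sym (trans (+-identityʳ _) (+-identityʳ _)) ⟩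
    mCut G (T [ u ]≔ true) ℕ.+ 0 ℕ.+ 0                       ≡⟨ cong (λ t → mCut G (T [ u ]≔ true) ℕ.+ t ℕ.+ t) no-nbrs ⟨
    mCut G (T [ u ]≔ true) ℕ.+ nbrsIn G T u ℕ.+ nbrsIn G T u ≡⟨ mCut-insert u u∉T ⟩
    mCut G T ℕ.+ deg G u                                     ≤⟨ +-monoʳ-≤ (mCut G T) du≤dw ⟩
    mCut G T ℕ.+ deg G w                                     ≡⟨ mCut-insert w w∉T ⟨
    mCut G (T [ w ]≔ true) ℕ.+ a ℕ.+ a                       ≡⟨ +-assoc (mCut G (T [ w ]≔ true)) a a ⟩
    mCut G (T [ w ]≔ true) ℕ.+ (a ℕ.+ a)                     ∎
    where
    open ≤-Reasoning
    open Insertion G T using (mCut-insert)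
    a = nbrsIn G T w

  cov-swap-≤ : ∀ α → 0ℚ ≤ℚ α → α ≤ℚ + 1 / 3 → {n : ℕ} (G : Graph n) (T : Subset n) (u w : Fin n) →
               lookup T u ≡ false → lookup T w ≡ false → (∀ v → lookup T v ≡ true → adj G u v ≡ false) →
               deg G u ≤ deg G w → cov α G (T [ u ]≔ true) ≤ℚ cov α G (T [ w ]≔ true)
  cov-swap-≤ α 0≤α α≤⅓ G T u w u∉T w∉T u-isolated du≤dw = begin
    cov α G (T [ u ]≔ true)
      ≡⟨ cong (λ m → (1ℚ - α) * ℕtoℚ m + α * ℕtoℚ (mCut G (T [ u ]≔ true))) mIn-Tu ⟩
    (1ℚ - α) * ℕtoℚ (mIn G T) + α * ℕtoℚ (mCut G (T [ u ]≔ true))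
      ≤⟨ swap-cost-≤ 0≤α α≤⅓ (mIn G T) (nbrsIn G T w) (mCut G (T [ w ]≔ true)) (mCut G (T [ u ]≔ true))
                         (mCut-swap-≤ G T u w u∉T w∉T no-nbrs du≤dw) ⟩
    (1ℚ - α) * ℕtoℚ (mIn G T ℕ.+ nbrsIn G T w) + α * ℕtoℚ (mCut G (T [ w ]≔ true))
      ≡⟨ cong (λ m → (1ℚ - α) * ℕtoℚ m + α * ℕtoℚ (mCut G (T [ w ]≔ true))) (mIn-insert w w∉T) ⟨
    cov α G (T [ w ]≔ true) ∎
    where
    open Rat.≤-Reasoning
    open Insertion G T using (mIn-insert)
    no-nbrs : nbrsIn G T u ≡ 0
    no-nbrs = nbrsIn≡0 G T u u-isolated
    mIn-Tu : mIn G (T [ u ]≔ true) ≡ mIn G T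
    mIn-Tu = trans (mIn-insert u u∉T) (trans (cong (mIn G T ℕ.+_) no-nbrs) (+-identityʳ (mIn G T)))

injective⇒surjective : {n : ℕ} {f : Fin n → Fin n} → Injective _≡_ _≡_ f → ∀ y → ∃ λ i → f i ≡ y
injective⇒surjective {ℕ.suc m} {f} f-inj y with any? (λ i → f i ≟ y)
... | yes found = found
... | no missed = contradiction (injective⇒≤ g-inj) (n≮n m)
  where
  y≢f : ∀ i → y ≢ f i
  y≢f i y≡fi = missed (i , sym y≡fi)
  g : Fin (ℕ.suc m) → Fin m
  g i = punchOut (y≢f i)
  g-inj : Injective _≡_ _≡_ g
  g-inj {i} {j} gi≡gj = f-inj (punchOut-injective (y≢f i) (y≢f j) gi≡gj)

no-prefix-nbr⇒isolated :
  {n : ℕ} (G : Graph n) (σ : Fin n → Fin n) → Injective _≡_ _≡_ σ → (C : Subset n) {j : Fin n} →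
  (∀ i → σ i ∈ C → i Fin.≤ j) → ∀ u →
  ¬ (Σ (Fin n) λ i′ → i′ Fin.≤ j × σ i′ ∈ C × adj G u (σ i′) ≡ true) → ∀ v → v ∈ C → adj G u v ≡ false
no-prefix-nbr⇒isolated G σ σ-inj C C⊆prefix u no-nbr v v∈C with injective⇒surjective σ-inj v
... | i′ , refl = ¬-not (λ adj≡true → no-nbr (i′ , C⊆prefix i′ v∈C , v∈C , adj≡true))

swap-preserves-solution :
  ∀ α → 0ℚ ≤ℚ α → α ≤ℚ + 1 / 3 → {n : ℕ} (G : Graph n) (k p : ℕ) (T : Subset n) (u w : Fin n) →
  lookup T u ≡ false → lookup T w ≡ false → (∀ v → lookup T v ≡ true → adj G u v ≡ false) →
  deg G u ≤ deg G w → IsSolution α G k p (T [ w ]≔ true) → IsSolution α G k p (T [ u ]≔ true)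
swap-preserves-solution α 0≤α α≤⅓ G k p T u w u∉T w∉T u-isolated du≤dw (∣Tw∣≡k , covTw≤p) =
  trans (∣insert∣ T u u∉T) (trans (sym (∣insert∣ T w w∉T)) ∣Tw∣≡k) ,
  Rat.≤-trans (cov-swap-≤ α 0≤α α≤⅓ G T u w u∉T w∉T u-isolated du≤dw) covTw≤p

lexMin⇒no-isolated-earlier :
  ∀ α → 0ℚ ≤ℚ α → α ≤ℚ + 1 / 3 → {n : ℕ} (G : Graph n) (k p : ℕ) (σ : Fin n → Fin n) →
  Injective _≡_ _≡_ σ → (C : Subset n) → IsLexMinSolution α G k p σ C →
  ∀ {i j} → i < j → σ i ∉ C → σ j ∈ C → deg G (σ i) ≤ deg G (σ j) →
  ¬ (∀ v → v ∈ C → adj G (σ i) v ≡ false)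
lexMin⇒no-isolated-earlier α 0≤α α≤⅓ {n} G k p σ σ-inj C (C-sol , C-min)
                            {i} {j} i<j σi∉C σj∈C du≤dw isolated =
  filter-≰lex (tabulate⁺-< id) (∈-allFin i) (∈-allFin j) (C-min (T [ u ]≔ true) swapped-sol)
  where
  u w : Fin n
  u = σ i
  w = σ j
  T : Subset n
  T = C [ w ]≔ false
  u∉T : lookup T u ≡ false
  u∉T = trans (lookup∘update′ (<⇒≢ i<j ∘ σ-inj) C false) (¬-not (σi∉C ∘ lookup⇒[]= u C))
  swapped-sol : IsSolution α G k p (T [ u ]≔ true)
  swapped-sol = swap-preserves-solution α 0≤α α≤⅓ G k p T u w u∉T (lookup∘update w C false)
    (λ v v∈T → isolated v (lookup⇒[]= v C (remove-⊆ C w v v∈T))) du≤dw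
    (subst (IsSolution α G k p) (sym (insert-remove C ([]=⇒lookup σj∈C))) C-sol)
  agrees-below-i : ∀ {x} → x < i → lookup (T [ u ]≔ true) (σ x) ≡ lookup C (σ x)
  agrees-below-i x<i = trans (lookup∘update′ (<⇒≢ x<i ∘ σ-inj) T true)
                             (lookup∘update′ (<⇒≢ (<-trans x<i i<j) ∘ σ-inj) C false)
  open FirstDifference (λ x → σ x ∈? C) (λ x → σ x ∈? (T [ u ]≔ true)) i<j
    (λ x<i σx∈C → lookup⇒[]= _ (T [ u ]≔ true) (trans (agrees-below-i x<i) ([]=⇒lookup σx∈C)))
    (λ x<i σx∈C′ → lookup⇒[]= _ C (trans (sym (agrees-below-i x<i)) ([]=⇒lookup σx∈C′)))
    ([]≔-updates T u) σi∉C σj∈C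

lemma8 : (α : ℚ) → 0ℚ ≤ℚ α → α ≤ℚ (+ 1 / 3) →
    (n : ℕ) (G : Graph n) (k p : ℕ) → YesInstance α G k p →
    (σ : Fin n → Fin n) → Injective _≡_ _≡_ σ →
    (∀ (i i' : Fin n) → i Fin.≤ i' → deg G (σ i) ≤ deg G (σ i')) →
    (C : Subset n) → IsLexMinSolution α G k p σ C →
    (j : Fin n) → σ j ∈ C → (∀ (i : Fin n) → σ i ∈ C → i Fin.≤ j) →
    IsDomSetOfPrefix G σ j k C
lemma8 α 0≤α α≤⅓ n G k p _ σ σ-inj σ-mono C C-lexMin j σj∈C C⊆prefix =
  C⊆prefix , proj₁ (proj₁ C-lexMin) , dominated
  where
  dominated : ∀ i → i Fin.≤ j →
              (σ i ∈ C) ⊎ (Σ (Fin n) λ i′ → i′ Fin.≤ j × σ i′ ∈ C × adj G (σ i) (σ i′) ≡ true)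
  dominated i i≤j =
    decidable-stable (σ i ∈? C ⊎-dec any? (λ i′ → i′ Fin.≤? j ×-dec σ i′ ∈? C ×-dec adj G (σ i) (σ i′) ≟ᵇ true))
      λ undominated → lexMin⇒no-isolated-earlier α 0≤α α≤⅓ G k p σ σ-inj C C-lexMin
                        (i<j (undominated ∘ inj₁)) (undominated ∘ inj₁) σj∈C (σ-mono i j i≤j)
                        (no-prefix-nbr⇒isolated G σ σ-inj C C⊆prefix (σ i) (undominated ∘ inj₂))
    where
    i<j : σ i ∉ C → i < j
    i<j σi∉C = ≤∧≢⇒< i≤j (λ { refl → σi∉C σj∈C })
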